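{- For all sequences $\overline{x},\overline{y},\overline{z}\in\mathsf{seq}$: if $\overline{x}\rightsquigarrow\overline{y}$, $\overline{x}\rightsquigarrow\overline{z}$, and both $\overline{y}$ and $\overline{z}$ are reduced, then $\overline{y}=\overline{z}$.
   Context: $\mathsf{seq}$ is the set of finite sequences over the alphabet $\{l,r,\lambda,\rho,n\}$, with juxtaposition denoting concatenation. One-step reduction $\rightsquigarrow'$ is the relation generated by the rules (for arbitrary $\overline{x},\overline{y}\in\mathsf{seq}$): $\overline{x}l\lambda\overline{y}\rightsquigarrow'\overline{x}\rho\overline{y}$; $\overline{x}r\lambda\overline{y}\rightsquigarrow'\overline{x}\overline{y}$; $\overline{x}\lambda r\overline{y}\rightsquigarrow'\overline{x}\overline{y}$; $\overline{x}\rho r\overline{y}\rightsquigarrow'\overline{x}l\overline{y}$; $\overline{x}nn\overline{y}\rightsquigarrow'\overline{x}\overline{y}$. A sequence is reduced if no one-step reduction applies to it. $\overline{x}\rightsquigarrow\overline{y}$ means $\overline{y}$ is obtained from $\overline{x}$ by a finite chain of one-step reductions. -}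

module Defs where

open import Data.List using (List; []; _∷_; _++_)
open import Relation.Binary.Construct.Closure.ReflexiveTransitive using (Star)
open import Relation.Nullary using (¬_)
open import Data.Product using (∃)

data Letter : Set where
  l r lam rho n : Letter

Seq : Set
Seq = List Letter

data _⇝′_ : Seq → Seq → Set where
  lλ→ρ : ∀ x y → (x ++ l ∷ lam ∷ y) ⇝′ (x ++ rho ∷ y)
  rλ→ε : ∀ x y → (x ++ r ∷ lam ∷ y) ⇝′ (x ++ y)
  λr→ε : ∀ x y → (x ++ lam ∷ r ∷ y) ⇝′ (x ++ y)
  ρr→l : ∀ x y → (x ++ rho ∷ r ∷ y) ⇝′ (x ++ l ∷ y)
  nn→ε : ∀ x y → (x ++ n ∷ n ∷ y) ⇝′ (x ++ y)

_⇝_ : Seq → Seq → Set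
_⇝_ = Star _⇝′_

Reduced : Seq → Set
Reduced x = ¬ ∃ (λ y → x ⇝′ y)

{-# OPTIONS --safe #-}
module Submission where

-- The normal form is computed right to left, like a stack machine: each letter is
-- pushed onto the already reduced suffix and contracts with its first letter when the
-- two form a redex. Pushing the two letters of a redex onto a reduced word has the same
-- effect as pushing its contractum (the overlaps lλr, rλr, λrλ, ρrλ and nnn resolve),
-- so the normal form is invariant under reduction; it also fixes reduced words. Hence
-- every reduced reduct of x is the normal form of x.

open import Defs
open import Data.List using ([]; _∷_; _++_; foldr)
open import Data.List.Properties using (foldr-++)
open import Data.List.Relation.Unary.Linked using (Linked; []; [-]; _∷_; tail)
open import Data.Product using (_,_)
open import Data.Empty using (⊥-elim)
open import Function using (_∘_)
open import Relation.Binary.Construct.Closure.ReflexiveTransitive using (fold)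
open import Relation.Binary.PropositionalEquality using (_≡_; refl; sym; trans; cong; module ≡-Reasoning)
open import Relation.Nullary using (¬_; Dec; yes; no)

data Redex : Letter → Letter → Set where
  lλ : Redex l lam
  rλ : Redex r lam
  λr : Redex lam r
  ρr : Redex rho r
  nn : Redex n n

contractum : ∀ {a b} → Redex a b → Seq
contractum lλ = rho ∷ []
contractum rλ = []
contractum λr = []
contractum ρr = l ∷ []
contractum nn = []

contract : ∀ {a b} (ρ : Redex a b) x y → (x ++ a ∷ b ∷ y) ⇝′ (x ++ contractum ρ ++ y)
contract lλ = lλ→ρ
contract rλ = rλ→ε
contract λr = λr→ε
contract ρr = ρr→l
contract nn = nn→ε

redex? : ∀ a b → Dec (Redex a b)
redex? l   lam = yes lλ
redex? r   lam = yes rλ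
redex? lam r   = yes λr
redex? rho r   = yes ρr
redex? n   n   = yes nn
redex? l   l   = no λ ()
redex? l   r   = no λ ()
redex? l   rho = no λ ()
redex? l   n   = no λ ()
redex? r   l   = no λ ()
redex? r   r   = no λ ()
redex? r   rho = no λ ()
redex? r   n   = no λ ()
redex? lam l   = no λ ()
redex? lam lam = no λ ()
redex? lam rho = no λ ()
redex? lam n   = no λ ()
redex? rho l   = no λ ()
redex? rho lam = no λ ()
redex? rho rho = no λ ()
redex? rho n   = no λ ()
redex? n   l   = no λ ()
redex? n   r   = no λ ()
redex? n   lam = no λ ()
redex? n   rho = no λ ()

l-redex⇒r-redex : ∀ {e} → Redex l e → Redex r e
l-redex⇒r-redex lλ = rλ

ρ-redex⇒λ-redex : ∀ {e} → Redex rho e → Redex lam e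
ρ-redex⇒λ-redex ρr = λr

Irreducible : Seq → Set
Irreducible = Linked (λ a b → ¬ Redex a b)

irreducible-replace-head : ∀ {a a′ w} → (∀ {e} → Redex a′ e → Redex a e) →
                           Irreducible (a ∷ w) → Irreducible (a′ ∷ w)
irreducible-replace-head f [-]        = [-]
irreducible-replace-head f (¬ρ ∷ irr) = ¬ρ ∘ f ∷ irr

⇝′-∷ : ∀ c {u v} → u ⇝′ v → (c ∷ u) ⇝′ (c ∷ v)
⇝′-∷ c (lλ→ρ x y) = lλ→ρ (c ∷ x) y
⇝′-∷ c (rλ→ε x y) = rλ→ε (c ∷ x) y
⇝′-∷ c (λr→ε x y) = λr→ε (c ∷ x) y
⇝′-∷ c (ρr→l x y) = ρr→l (c ∷ x) y
⇝′-∷ c (nn→ε x y) = nn→ε (c ∷ x) y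

reduced-tail : ∀ {c w} → Reduced (c ∷ w) → Reduced w
reduced-tail red (v , w⇝′v) = red (_ , ⇝′-∷ _ w⇝′v)

reduced⇒irreducible : ∀ w → Reduced w → Irreducible w
reduced⇒irreducible []          red = []
reduced⇒irreducible (a ∷ [])    red = [-]
reduced⇒irreducible (a ∷ b ∷ w) red =
  (λ ρ → red (_ , contract ρ [] w)) ∷ reduced⇒irreducible (b ∷ w) (reduced-tail red)

push : Letter → Seq → Seq
push c []      = c ∷ []
push c (d ∷ w) with redex? c d
... | yes ρ = contractum ρ ++ w
... | no _  = c ∷ d ∷ w

nf : Seq → Seq
nf = foldr push []

push-fixes-irreducible : ∀ {c w} → Irreducible (c ∷ w) → push c w ≡ c ∷ w
push-fixes-irreducible {w = []}    _        = refl
push-fixes-irreducible {c} {d ∷ w} (¬ρ ∷ _) with redex? c d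
... | yes ρ = ⊥-elim (¬ρ ρ)
... | no _  = refl

contractum-irreducible : ∀ {a b w} (ρ : Redex a b) →
                         Irreducible (b ∷ w) → Irreducible (contractum ρ ++ w)
contractum-irreducible lλ = irreducible-replace-head ρ-redex⇒λ-redex
contractum-irreducible rλ = tail
contractum-irreducible λr = tail
contractum-irreducible ρr = irreducible-replace-head l-redex⇒r-redex
contractum-irreducible nn = tail

push-irreducible : ∀ c {w} → Irreducible w → Irreducible (push c w)
push-irreducible c {[]}    _   = [-]
push-irreducible c {d ∷ w} irr with redex? c d
... | yes ρ = contractum-irreducible ρ irr
... | no ¬ρ = ¬ρ ∷ irr

push-redex : ∀ {a b} (ρ : Redex a b) {w} → Irreducible w →
             push a (push b w) ≡ foldr push w (contractum ρ)
push-redex lλ {[]}    _   = refl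
push-redex lλ {d ∷ w} irr with redex? lam d
... | yes λr = push-fixes-irreducible (irreducible-replace-head l-redex⇒r-redex irr)
... | no ¬σ  = sym (push-fixes-irreducible (irreducible-replace-head ρ-redex⇒λ-redex (¬σ ∷ irr)))
push-redex rλ {[]}    _   = refl
push-redex rλ {d ∷ w} irr with redex? lam d
... | yes λr = push-fixes-irreducible irr
... | no _   = refl
push-redex λr {[]}    _   = refl
push-redex λr {d ∷ w} irr with redex? r d
... | yes rλ = push-fixes-irreducible irr
... | no _   = refl
push-redex ρr {[]}    _   = refl
push-redex ρr {d ∷ w} irr with redex? r d
... | yes rλ = push-fixes-irreducible (irreducible-replace-head ρ-redex⇒λ-redex irr)
... | no ¬σ  = sym (push-fixes-irreducible (irreducible-replace-head l-redex⇒r-redex (¬σ ∷ irr)))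
push-redex nn {[]}    _   = refl
push-redex nn {d ∷ w} irr with redex? n d
... | yes nn = push-fixes-irreducible irr
... | no _   = refl

nf-irreducible : ∀ x → Irreducible (nf x)
nf-irreducible []      = []
nf-irreducible (c ∷ x) = push-irreducible c (nf-irreducible x)

nf-fixes-irreducible : ∀ {x} → Irreducible x → nf x ≡ x
nf-fixes-irreducible {[]}    _   = refl
nf-fixes-irreducible {c ∷ x} irr =
  trans (cong (push c) (nf-fixes-irreducible (tail irr))) (push-fixes-irreducible irr)

nf-contract : ∀ {a b} (ρ : Redex a b) x y → nf (x ++ a ∷ b ∷ y) ≡ nf (x ++ contractum ρ ++ y)
nf-contract {a} {b} ρ x y = begin
  nf (x ++ a ∷ b ∷ y)                         ≡⟨ foldr-++ push [] x (a ∷ b ∷ y) ⟩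
  foldr push (push a (push b (nf y))) x       ≡⟨ cong (λ w → foldr push w x) (push-redex ρ (nf-irreducible y)) ⟩
  foldr push (foldr push (nf y) (contractum ρ)) x
                                              ≡⟨ cong (λ w → foldr push w x) (foldr-++ push [] (contractum ρ) y) ⟨
  foldr push (nf (contractum ρ ++ y)) x       ≡⟨ foldr-++ push [] x (contractum ρ ++ y) ⟨
  nf (x ++ contractum ρ ++ y)                 ∎
  where open ≡-Reasoning

nf-⇝′ : ∀ {u v} → u ⇝′ v → nf u ≡ nf v
nf-⇝′ (lλ→ρ x y) = nf-contract lλ x y
nf-⇝′ (rλ→ε x y) = nf-contract rλ x y
nf-⇝′ (λr→ε x y) = nf-contract λr x y
nf-⇝′ (ρr→l x y) = nf-contract ρr x y
nf-⇝′ (nn→ε x y) = nf-contract nn x y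

nf-⇝ : ∀ {u v} → u ⇝ v → nf u ≡ nf v
nf-⇝ = fold (λ u v → nf u ≡ nf v) (trans ∘ nf-⇝′) refl

nf-fixes-reduced : ∀ y → Reduced y → nf y ≡ y
nf-fixes-reduced y = nf-fixes-irreducible ∘ reduced⇒irreducible y

theorem24 : ∀ (x y z : Seq) → x ⇝ y → x ⇝ z → Reduced y → Reduced z → y ≡ z
theorem24 x y z x⇝y x⇝z red-y red-z = begin
  y    ≡⟨ nf-fixes-reduced y red-y ⟨
  nf y ≡⟨ nf-⇝ x⇝y ⟨
  nf x ≡⟨ nf-⇝ x⇝z ⟩
  nf z ≡⟨ nf-fixes-reduced z red-z ⟩
  z    ∎
  where open ≡-Reasoning
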